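{- Let $k,s,l$ be positive integers with $s\geq 1$ and $k,l\geq 2$. For every real $\epsilon>0$ there exists an integer $n_\epsilon$ such that for all $n\geq n_\epsilon$ the following holds: if $\mathcal{H}\subseteq\binom{[n]}{k}$ satisfies $\nu(\mathcal{H})\leq s$ and $$N(S_{k,l}^{k-1},\mathcal{H})\geq \left(\frac{s-1}{(k-2)!\,l!}+\epsilon\right)n^{k+l-2},$$ then $\mathcal{H}$ is the union of $s$ different trivial intersecting families.
   Context: $[n]=\{1,\dots,n\}$, $\binom{[n]}{k}$ is the family of $k$-subsets of $[n]$, and $\nu(\mathcal{H})$ is the largest number of pairwise disjoint members of $\mathcal{H}$. A family $\{A_1,\dots,A_l\}\subseteq\binom{[n]}{k}$ is a $k$-uniform sunflower with $l$ petals if there is a core $C$ contained in every $A_i$ with the sets $A_i\setminus C$ pairwise disjoint; $S_{k,l}^{k-1}$ is such a sunflower with core of size $k-1$, and $N(S_{k,l}^{k-1},\mathcal{H})$ is the number of $l$-element subfamilies of $\mathcal{H}$ forming a copy of $S_{k,l}^{k-1}$. A family is intersecting if any two members intersect, and trivial intersecting if the intersection of all its members is nonempty. "$\mathcal{H}$ is the union of $s$ different trivial intersecting families" means $\mathcal{H}=\bigcup_{i=1}^s\mathcal{G}_i$ where each $\mathcal{G}_i$ is a trivial intersecting family with common element $x_i$, the $x_i$ being distinct.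
   Formalization: The parameter ε ranges over the positive rationals instead of the positive reals. -}

module Defs where

open import Data.Bool using (Bool)
import Data.Bool.Properties as BoolP
open import Data.Nat using (ℕ; _≤_; _∸_; _*_; _!)
open import Data.Nat.Properties using (_!*_!≢0)
open import Data.Fin using (Fin)
open import Data.Fin.Subset using (Subset; _∩_; _─_; ⊥; ∣_∣; _⊆_; _∈_)
open import Data.Fin.Subset.Properties using (_⊆?_; anySubset?)
open import Data.List using (List; []; _∷_; map; _++_; filter; length)
open import Data.List.Relation.Unary.All using (All; all?)
open import Data.List.Relation.Unary.AllPairs using (AllPairs; allPairs?)
open import Data.List.Relation.Unary.Unique.Propositional using (Unique)
import Data.List.Membership.Propositional as LM
open import Data.Vec.Properties using (≡-dec)
open import Data.Product using (Σ; ∃; _×_; _,_)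
open import Data.Integer using (+_)
open import Data.Rational using (ℚ; _/_)
open import Relation.Binary.PropositionalEquality using (_≡_; _≢_)
open import Relation.Nullary using (Dec; _×-dec_)
open import Function using (_⇔_)
import Data.Nat as Nat

infix 4 _∈L_
_∈L_ : ∀ {a} {A : Set a} → A → List A → Set a
_∈L_ = LM._∈_

record IsKFamily (n k : ℕ) (H : List (Subset n)) : Set where
  field
    unique  : Unique H
    uniform : All (λ A → ∣ A ∣ ≡ k) H

Disjoint : ∀ {n} → Subset n → Subset n → Set
Disjoint A B = A ∩ B ≡ ⊥

disjoint? : ∀ {n} (A B : Subset n) → Dec (Disjoint A B)
disjoint? A B = ≡-dec BoolP._≟_ (A ∩ B) ⊥

ν≤ : ∀ {n} → List (Subset n) → ℕ → Set
ν≤ {n} H s = (M : List (Subset n)) → Unique M → All (_∈L H) M →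
             AllPairs Disjoint M → length M ≤ s

IsSunflowerWithCore : ∀ {n} → Subset n → List (Subset n) → Set
IsSunflowerWithCore C L = All (C ⊆_) L × AllPairs (λ A B → Disjoint (A ─ C) (B ─ C)) L

-- L is a copy of S^{k-1}_{k,l} (the number l of petals is fixed by counting
-- only l-element subfamilies, see N below): a sunflower with core of size k-1.
IsS : ∀ {n} → ℕ → List (Subset n) → Set
IsS k L = ∃ λ C → ∣ C ∣ ≡ k ∸ 1 × IsSunflowerWithCore C L

IsS? : ∀ {n} k (L : List (Subset n)) → Dec (IsS k L)
IsS? k L = anySubset? (λ C → (∣ C ∣ Nat.≟ (k ∸ 1)) ×-dec
  (all? (C ⊆?_) L ×-dec allPairs? (λ A B → disjoint? (A ─ C) (B ─ C)) L))

-- all l-element sublists (= l-element subfamilies, for a duplicate-free list)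
combinations : ∀ {a} {A : Set a} → ℕ → List A → List (List A)
combinations Nat.zero    _        = [] ∷ []
combinations (Nat.suc l) []       = []
combinations (Nat.suc l) (x ∷ xs) = map (x ∷_) (combinations l xs) ++ combinations (Nat.suc l) xs

NS : ∀ {n} → (k l : ℕ) → List (Subset n) → ℕ
NS k l H = length (filter (IsS? k) (combinations l H))

coeff : (k s l : ℕ) → ℚ
coeff k s l = _/_ (+ (s ∸ 1)) ((k ∸ 2) ! * l !) {{(k ∸ 2) !* l !≢0}}

TrivialIntersectingAt : ∀ {n} → Fin n → List (Subset n) → Set
TrivialIntersectingAt x G = G ≢ [] × All (x ∈_) G

UnionOfTrivialIntersecting : ∀ {n} → ℕ → List (Subset n) → Set
UnionOfTrivialIntersecting {n} s H =
  Σ (Fin s → Fin n) λ x → Σ (Fin s → List (Subset n)) λ G →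
    (∀ i j → x i ≡ x j → i ≡ j) ×
    (∀ i → TrivialIntersectingAt (x i) (G i)) ×
    (∀ A → (A ∈L H) ⇔ (∃ λ i → A ∈L G i))

ℕ→ℚ : ℕ → ℚ
ℕ→ℚ m = (+ m) / 1

-- Let M be a maximal matching of H, so |M| ≤ s and its vertex set T, of at most sk points,
-- meets every member. Call a vertex heavy if more than (s+1)k·C(n,k-2) members contain it.
-- At most that many members contain a given vertex and meet a given set of at most (s+1)k
-- other points, so if there are s heavy vertices, every member contains one of them: otherwise
-- a member avoiding them extends, one heavy vertex at a time, to s+1 pairwise disjoint members.
-- Otherwise at most s-1 vertices are heavy, and we sort the copies of S^{k-1}_{k,l} by their
-- core. A copy whose core contains a heavy vertex y is determined by y, the other k-2 points of
-- its core and its l petal points, so there are at most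
-- (s-1)·C(n,k-2)·C(n,l) ≤ (s-1)/((k-2)!l!)·n^{k+l-2} such copies.
-- If the core meets T only in light vertices, choosing a member through such a vertex, its
-- petal point and the other l-1 petal points gives O(n^{k+l-3}) copies; if the core misses T,
-- all petal points lie in T, leaving O(n^{k-1}) copies. For n large compared with the
-- denominator of ε this contradicts the assumed lower bound.

module Submission where

open import Defs
open import Data.Nat using (ℕ; _≤_)
open import Data.Nat.Base using (_+_; _∸_; _^_)
open import Data.Fin.Subset using (Subset)
open import Data.List using (List)
open import Data.Product using (∃; _×_)

module Subsets where

  open import Data.Nat.Base using (ℕ; zero; suc; s≤s)
  open import Data.Nat.Properties using (suc-injective; <-irrefl; ≤-trans; ≤-reflexive)
  open import Data.Fin.Base using (Fin; zero; suc)
  open import Data.Fin.Subset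
  open import Data.Fin.Subset.Properties
    using (x∈⁅x⁆; x∈⁅y⁆⇒x≡y; p⊆q⇒∣p∣≤∣q∣; drop-there; drop-∷-⊆; ∉⊥; ∣⊥∣≡0; ∪-identityʳ; p─⊥≡p;
           Empty-unique; nonempty?; x∈p∩q⁺; x∈p∩q⁻; x∈p∪q⁺; x∈p∪q⁻)
  open import Data.Vec.Base using ([]; _∷_; here; there)
  open import Data.List.Base using (List; []; _∷_; map; length)
  open import Data.List.Properties using (length-map)
  open import Data.List.Relation.Unary.Any using (here; there)
  open import Data.List.Relation.Unary.All as All using (All; []; _∷_)
  open import Data.List.Relation.Unary.Unique.Propositional using (Unique; []; _∷_)
  import Data.List.Membership.Propositional as List
  open import Data.List.Membership.Propositional.Properties using (∈-map⁺; ∈-map⁻)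
  open import Data.Product.Base using (∃; _×_; _,_)
  open import Data.Sum.Base using (_⊎_; inj₁; inj₂)
  open import Function.Base using (_∘_)
  open import Relation.Nullary using (yes; no)
  open import Relation.Nullary.Negation using (contradiction)
  open import Relation.Binary.PropositionalEquality using (_≡_; refl; sym; trans; cong; cong₂; subst)

  private variable n : ℕ

  x∈p⇒p-x∪⁅x⁆≡p : (p : Subset n) {x : Fin n} → x ∈ p → (p - x) ∪ ⁅ x ⁆ ≡ p
  x∈p⇒p-x∪⁅x⁆≡p (inside ∷ p) here = cong (inside ∷_) (trans (∪-identityʳ (p ─ ⊥)) (p─⊥≡p p))
  x∈p⇒p-x∪⁅x⁆≡p (inside ∷ p) (there x∈p) = cong (inside ∷_) (x∈p⇒p-x∪⁅x⁆≡p p x∈p)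
  x∈p⇒p-x∪⁅x⁆≡p (outside ∷ p) (there x∈p) = cong (outside ∷_) (x∈p⇒p-x∪⁅x⁆≡p p x∈p)

  x∉p⇒[p∪⁅x⁆]-x≡p : (p : Subset n) {x : Fin n} → x ∉ p → (p ∪ ⁅ x ⁆) - x ≡ p
  x∉p⇒[p∪⁅x⁆]-x≡p (outside ∷ p) {zero} x∉p = cong (outside ∷_) (trans (p─⊥≡p (p ∪ ⊥)) (∪-identityʳ p))
  x∉p⇒[p∪⁅x⁆]-x≡p (inside ∷ p) {zero} x∉p = contradiction here x∉p
  x∉p⇒[p∪⁅x⁆]-x≡p (inside ∷ p) {suc x} x∉p = cong (inside ∷_) (x∉p⇒[p∪⁅x⁆]-x≡p p (x∉p ∘ there))
  x∉p⇒[p∪⁅x⁆]-x≡p (outside ∷ p) {suc x} x∉p = cong (outside ∷_) (x∉p⇒[p∪⁅x⁆]-x≡p p (x∉p ∘ there))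

  x∈p⇒1+∣p-x∣≡∣p∣ : (p : Subset n) {x : Fin n} → x ∈ p → suc ∣ p - x ∣ ≡ ∣ p ∣
  x∈p⇒1+∣p-x∣≡∣p∣ (inside ∷ p) here = cong (suc ∘ ∣_∣) (p─⊥≡p p)
  x∈p⇒1+∣p-x∣≡∣p∣ (inside ∷ p) (there x∈p) = cong suc (x∈p⇒1+∣p-x∣≡∣p∣ p x∈p)
  x∈p⇒1+∣p-x∣≡∣p∣ (outside ∷ p) (there x∈p) = x∈p⇒1+∣p-x∣≡∣p∣ p x∈p

  x∉p⇒∣p∪⁅x⁆∣≡1+∣p∣ : (p : Subset n) {x : Fin n} → x ∉ p → ∣ p ∪ ⁅ x ⁆ ∣ ≡ suc ∣ p ∣
  x∉p⇒∣p∪⁅x⁆∣≡1+∣p∣ (outside ∷ p) {zero} x∉p = cong (suc ∘ ∣_∣) (∪-identityʳ p)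
  x∉p⇒∣p∪⁅x⁆∣≡1+∣p∣ (inside ∷ p) {zero} x∉p = contradiction here x∉p
  x∉p⇒∣p∪⁅x⁆∣≡1+∣p∣ (inside ∷ p) {suc x} x∉p = cong suc (x∉p⇒∣p∪⁅x⁆∣≡1+∣p∣ p (x∉p ∘ there))
  x∉p⇒∣p∪⁅x⁆∣≡1+∣p∣ (outside ∷ p) {suc x} x∉p = x∉p⇒∣p∪⁅x⁆∣≡1+∣p∣ p (x∉p ∘ there)

  p⊆q∧∣q∣≡∣p∣⇒q≡p : (p q : Subset n) → p ⊆ q → ∣ q ∣ ≡ ∣ p ∣ → q ≡ p
  p⊆q∧∣q∣≡∣p∣⇒q≡p [] [] _ _ = refl
  p⊆q∧∣q∣≡∣p∣⇒q≡p (inside ∷ p) (inside ∷ q) p⊆q e =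
    cong (inside ∷_) (p⊆q∧∣q∣≡∣p∣⇒q≡p p q (drop-∷-⊆ p⊆q) (suc-injective e))
  p⊆q∧∣q∣≡∣p∣⇒q≡p (outside ∷ p) (outside ∷ q) p⊆q e =
    cong (outside ∷_) (p⊆q∧∣q∣≡∣p∣⇒q≡p p q (drop-∷-⊆ p⊆q) e)
  p⊆q∧∣q∣≡∣p∣⇒q≡p (inside ∷ p) (outside ∷ q) p⊆q e with () ← p⊆q here
  p⊆q∧∣q∣≡∣p∣⇒q≡p (outside ∷ p) (inside ∷ q) p⊆q e =
    contradiction (≤-trans (s≤s (p⊆q⇒∣p∣≤∣q∣ (drop-∷-⊆ p⊆q))) (≤-reflexive e)) (<-irrefl refl)

  p⊆q∧∣q∣≡1+∣p∣⇒q≡p∪⁅x⁆ : (p q : Subset n) → p ⊆ q → ∣ q ∣ ≡ suc ∣ p ∣ →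
                           ∃ λ x → x ∉ p × q ≡ p ∪ ⁅ x ⁆
  p⊆q∧∣q∣≡1+∣p∣⇒q≡p∪⁅x⁆ (inside ∷ p) (inside ∷ q) p⊆q e
    with x , x∉p , q≡ ← p⊆q∧∣q∣≡1+∣p∣⇒q≡p∪⁅x⁆ p q (drop-∷-⊆ p⊆q) (suc-injective e)
    = suc x , x∉p ∘ drop-there , cong (inside ∷_) q≡
  p⊆q∧∣q∣≡1+∣p∣⇒q≡p∪⁅x⁆ (outside ∷ p) (outside ∷ q) p⊆q e
    with x , x∉p , q≡ ← p⊆q∧∣q∣≡1+∣p∣⇒q≡p∪⁅x⁆ p q (drop-∷-⊆ p⊆q) e
    = suc x , x∉p ∘ drop-there , cong (outside ∷_) q≡
  p⊆q∧∣q∣≡1+∣p∣⇒q≡p∪⁅x⁆ (inside ∷ p) (outside ∷ q) p⊆q e with () ← p⊆q here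
  p⊆q∧∣q∣≡1+∣p∣⇒q≡p∪⁅x⁆ (outside ∷ p) (inside ∷ q) p⊆q e =
    zero , (λ ()) , cong (inside ∷_)
      (trans (p⊆q∧∣q∣≡∣p∣⇒q≡p p q (drop-∷-⊆ p⊆q) (suc-injective e)) (sym (∪-identityʳ p)))

  Disjoint⁺ : {A B : Subset n} → (∀ {x} → x ∈ A → x ∉ B) → Disjoint A B
  Disjoint⁺ {A = A} {B} f = Empty-unique λ (x , x∈A∩B) → let x∈A , x∈B = x∈p∩q⁻ A B x∈A∩B in f x∈A x∈B

  Disjoint⁻ : {A B : Subset n} → Disjoint A B → ∀ {x} → x ∈ A → x ∉ B
  Disjoint⁻ A∩B≡⊥ x∈A x∈B = ∉⊥ (subst (_ ∈_) A∩B≡⊥ (x∈p∩q⁺ (x∈A , x∈B)))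

  elements : Subset n → List (Fin n)
  elements []            = []
  elements (inside ∷ p)  = zero ∷ map suc (elements p)
  elements (outside ∷ p) = map suc (elements p)

  length-elements : (p : Subset n) → length (elements p) ≡ ∣ p ∣
  length-elements []            = refl
  length-elements (inside ∷ p)  = cong suc (trans (length-map suc (elements p)) (length-elements p))
  length-elements (outside ∷ p) = trans (length-map suc (elements p)) (length-elements p)

  ∈-elements⁺ : (p : Subset n) {x : Fin n} → x ∈ p → x List.∈ elements p
  ∈-elements⁺ (inside ∷ p)  here        = here refl
  ∈-elements⁺ (inside ∷ p)  (there x∈p) = there (∈-map⁺ suc (∈-elements⁺ p x∈p))
  ∈-elements⁺ (outside ∷ p) (there x∈p) = ∈-map⁺ suc (∈-elements⁺ p x∈p)

  ∈-elements⁻ : (p : Subset n) {x : Fin n} → x List.∈ elements p → x ∈ p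
  ∈-elements⁻ (inside ∷ p) (here refl) = here
  ∈-elements⁻ (inside ∷ p) (there x∈) with _ , y∈ , refl ← ∈-map⁻ suc x∈ = there (∈-elements⁻ p y∈)
  ∈-elements⁻ (outside ∷ p) x∈ with _ , y∈ , refl ← ∈-map⁻ suc x∈ = there (∈-elements⁻ p y∈)

  fromList : List (Fin n) → Subset n
  fromList []       = ⊥
  fromList (x ∷ xs) = fromList xs ∪ ⁅ x ⁆

  ∈-fromList⁺ : {xs : List (Fin n)} {x : Fin n} → x List.∈ xs → x ∈ fromList xs
  ∈-fromList⁺ {xs = y ∷ xs} (here refl) = x∈p∪q⁺ (inj₂ (x∈⁅x⁆ y))
  ∈-fromList⁺ (there x∈xs)              = x∈p∪q⁺ (inj₁ (∈-fromList⁺ x∈xs))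

  ∈-fromList⁻ : (xs : List (Fin n)) {x : Fin n} → x ∈ fromList xs → x List.∈ xs
  ∈-fromList⁻ [] x∈⊥ = contradiction x∈⊥ ∉⊥
  ∈-fromList⁻ (y ∷ xs) x∈ with x∈p∪q⁻ (fromList xs) ⁅ y ⁆ x∈
  ... | inj₁ x∈xs = there (∈-fromList⁻ xs x∈xs)
  ... | inj₂ x∈y  = here (x∈⁅y⁆⇒x≡y y x∈y)

  ∣fromList∣≡length : {xs : List (Fin n)} → Unique xs → ∣ fromList xs ∣ ≡ length xs
  ∣fromList∣≡length {n} {[]} [] = ∣⊥∣≡0 n
  ∣fromList∣≡length {xs = x ∷ xs} (x∉xs ∷ xs!) =
    trans (x∉p⇒∣p∪⁅x⁆∣≡1+∣p∣ (fromList xs) x∉) (cong suc (∣fromList∣≡length xs!))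
    where
    x∉ : x ∉ fromList xs
    x∉ x∈ = All.lookup x∉xs (∈-fromList⁻ xs x∈) refl

  ∣p∣≡1+m⇒Nonempty : {p : Subset n} {m : ℕ} → ∣ p ∣ ≡ suc m → Nonempty p
  ∣p∣≡1+m⇒Nonempty {p = inside ∷ p}  _ = zero , here
  ∣p∣≡1+m⇒Nonempty {p = outside ∷ p} e with x , x∈p ← ∣p∣≡1+m⇒Nonempty {p = p} e = suc x , there x∈p

  meet-or-Disjoint : (A B : Subset n) → Nonempty (A ∩ B) ⊎ Disjoint A B
  meet-or-Disjoint A B with nonempty? (A ∩ B)
  ... | yes meet = inj₁ meet
  ... | no  void = inj₂ (Empty-unique void)

  onCore : Subset n → List (Fin n) → List (Subset n)
  onCore K = map (λ p → K ∪ ⁅ p ⁆)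

  petals : (K : Subset n) (L : List (Subset n)) → All (λ A → K ⊆ A × ∣ A ∣ ≡ suc ∣ K ∣) L →
    ∃ λ ps → L ≡ onCore K ps × All (_∉ K) ps
  petals K []      []                  = [] , refl , []
  petals K (A ∷ L) ((K⊆A , ∣A∣) ∷ L⊇K)
    with p , p∉K , A≡ ← p⊆q∧∣q∣≡1+∣p∣⇒q≡p∪⁅x⁆ K A K⊆A ∣A∣
       | ps , L≡ , ps∉K ← petals K L L⊇K
    = p ∷ ps , cong₂ _∷_ A≡ L≡ , p∉K ∷ ps∉K

module ListCombinatorics where

  open import Level using (Level)
  open import Data.Nat.Base using (ℕ; zero; suc; _≤_; _*_; _^_; _+_; z≤n; s≤s)
  open import Data.Nat.Properties using (≤-refl; ≤-trans; ≤-reflexive; +-mono-≤; +-suc)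
  open import Data.Fin.Base using (Fin; zero; suc)
  open import Data.List.Base using (List; []; _∷_; [_]; map; length; _++_; filter; concatMap)
  open import Data.List.Properties using (length-++; length-map; filter-accept; filter-reject; ∷-injectiveʳ)
  open import Data.List.Relation.Unary.Any using (here; there)
  open import Data.List.Relation.Unary.All as All using (All; []; _∷_)
  open import Data.List.Relation.Unary.Unique.Propositional using (Unique; []; _∷_)
  import Data.List.Relation.Unary.Unique.Propositional.Properties as Unique
  open import Data.List.Relation.Binary.Sublist.Propositional as Sublist using ([]; _∷_; _∷ʳ_)
    renaming (_⊆_ to _⊑_)
  open import Data.List.Membership.Propositional using (_∈_; lose)
  open import Data.List.Membership.Propositional.Properties
    using (∈-map⁺; ∈-map⁻; ∈-++⁺ˡ; ∈-++⁺ʳ; ∈-++⁻; ∈-∃++; ∈-concatMap⁺)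
  open import Data.Product.Base using (_×_; _,_; proj₁)
  open import Data.Sum.Base using (inj₁; inj₂)
  open import Function.Base using (_∘_; case_of_)
  open import Function.Bundles using (_⇔_; mk⇔; Equivalence)
  open import Relation.Nullary.Negation using (¬_; contradiction)
  open import Relation.Unary using (Pred; Decidable)
  open import Relation.Binary.PropositionalEquality using (_≡_; refl; sym; trans; cong; subst)

  private variable
    a p : Level
    A B : Set a

  Unique∧⊆⇒length≤ : {xs ys : List A} → Unique xs → (∀ {x} → x ∈ xs → x ∈ ys) → length xs ≤ length ys
  Unique∧⊆⇒length≤ {xs = []} [] _ = z≤n
  Unique∧⊆⇒length≤ {xs = x ∷ xs} (x∉xs ∷ xs!) xs⊆ys with us , vs , refl ← ∈-∃++ (xs⊆ys (here refl)) =
    subst (suc (length xs) ≤_) (sym length-us++x∷vs) (s≤s (Unique∧⊆⇒length≤ xs! xs⊆us++vs))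
    where
    length-us++x∷vs : length (us ++ [ x ] ++ vs) ≡ suc (length (us ++ vs))
    length-us++x∷vs = trans (length-++ us) (trans (+-suc (length us) (length vs)) (cong suc (sym (length-++ us))))
    xs⊆us++vs : ∀ {y} → y ∈ xs → y ∈ us ++ vs
    xs⊆us++vs y∈xs with ∈-++⁻ us (xs⊆ys (there y∈xs))
    ... | inj₁ y∈us          = ∈-++⁺ˡ y∈us
    ... | inj₂ (here refl)   = contradiction refl (All.lookup x∉xs y∈xs)
    ... | inj₂ (there y∈vs)  = ∈-++⁺ʳ us y∈vs

  length-concatMap-≤ : (f : A → List B) (xs : List A) {c : ℕ} →
    (∀ {x} → x ∈ xs → length (f x) ≤ c) → length (concatMap f xs) ≤ length xs * c
  length-concatMap-≤ f []       _ = z≤n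
  length-concatMap-≤ f (x ∷ xs) f≤c = subst (_≤ _) (sym (length-++ (f x)))
    (+-mono-≤ (f≤c (here refl)) (length-concatMap-≤ f xs (f≤c ∘ there)))

  ∈-concatMap-∈ : (f : A → List B) {xs : List A} {x : A} {y : B} → x ∈ xs → y ∈ f x → y ∈ concatMap f xs
  ∈-concatMap-∈ f x∈xs y∈fx = ∈-concatMap⁺ f (lose x∈xs y∈fx)

  tuples : ℕ → List A → List (List A)
  tuples zero    T = [ [] ]
  tuples (suc m) T = concatMap (λ t → map (t ∷_) (tuples m T)) T

  length-tuples-≤ : (m : ℕ) (T : List A) → length (tuples m T) ≤ length T ^ m
  length-tuples-≤ zero    T = ≤-refl
  length-tuples-≤ (suc m) T = length-concatMap-≤ _ T λ _ →
    ≤-trans (≤-reflexive (length-map _ (tuples m T))) (length-tuples-≤ m T)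

  ∈-tuples : (T xs : List A) → All (_∈ T) xs → xs ∈ tuples (length xs) T
  ∈-tuples T []       []            = here refl
  ∈-tuples T (x ∷ xs) (x∈T ∷ xs⊆T) =
    ∈-concatMap-∈ (λ t → map (t ∷_) (tuples (length xs) T)) x∈T (∈-map⁺ (x ∷_) (∈-tuples T xs xs⊆T))

  Unique-resp-⊒ : {xs ys : List A} → xs ⊑ ys → Unique ys → Unique xs
  Unique-resp-⊒ []            []           = []
  Unique-resp-⊒ (y ∷ʳ xs⊑ys)  (_ ∷ ys!)    = Unique-resp-⊒ xs⊑ys ys!
  Unique-resp-⊒ (refl ∷ xs⊑ys) (y∉ys ∷ ys!) =
    All.tabulate (λ x∈xs → All.lookup y∉ys (Sublist.lookup xs⊑ys x∈xs)) ∷ Unique-resp-⊒ xs⊑ys ys!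

  ∈-combinations⁻ : (l : ℕ) (xs : List A) {ys : List A} → ys ∈ combinations l xs → ys ⊑ xs × length ys ≡ l
  ∈-combinations⁻ zero    []       (here refl) = [] , refl
  ∈-combinations⁻ zero    (x ∷ xs) (here refl)
    with ⊑xs , len ← ∈-combinations⁻ zero xs (here refl) = x ∷ʳ ⊑xs , len
  ∈-combinations⁻ (suc l) (x ∷ xs) ys∈ with ∈-++⁻ (map (x ∷_) (combinations l xs)) ys∈
  ... | inj₂ ys∈′ with ⊑xs , len ← ∈-combinations⁻ (suc l) xs ys∈′ = x ∷ʳ ⊑xs , len
  ... | inj₁ ys∈′ with zs , zs∈ , refl ← ∈-map⁻ (x ∷_) ys∈′
                  with ⊑xs , len ← ∈-combinations⁻ l xs zs∈ = refl ∷ ⊑xs , cong suc len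

  Unique-combinations : (l : ℕ) {xs : List A} → Unique xs → Unique (combinations l xs)
  Unique-combinations zero    _            = [] ∷ []
  Unique-combinations (suc l) []           = []
  Unique-combinations (suc l) {x ∷ xs} (x∉xs ∷ xs!) =
    Unique.++⁺ (Unique.map⁺ ∷-injectiveʳ (Unique-combinations l xs!)) (Unique-combinations (suc l) xs!) apart
    where
    apart : ∀ {ys} → ¬ (ys ∈ map (x ∷_) (combinations l xs) × ys ∈ combinations (suc l) xs)
    apart (ys∈ , ys∈′) with _ , _ , refl ← ∈-map⁻ (x ∷_) ys∈ =
      All.lookup x∉xs (Sublist.lookup (proj₁ (∈-combinations⁻ (suc l) xs ys∈′)) (here refl)) refl

  ⊑-unique⇒≡filter : {P : Pred A p} (P? : Decidable P) {xs ys : List A} → xs ⊑ ys → Unique ys →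
    (∀ {x} → x ∈ ys → x ∈ xs ⇔ P x) → xs ≡ filter P? ys
  ⊑-unique⇒≡filter P? [] [] _ = refl
  ⊑-unique⇒≡filter {P = P} P? (y ∷ʳ xs⊑ys) (y∉ys ∷ ys!) xs≈P =
    trans (⊑-unique⇒≡filter P? xs⊑ys ys! (xs≈P ∘ there)) (sym (filter-reject P? ¬Py))
    where
    ¬Py : ¬ P y
    ¬Py Py = All.lookup y∉ys (Sublist.lookup xs⊑ys (Equivalence.from (xs≈P (here refl)) Py)) refl
  ⊑-unique⇒≡filter {P = P} P? {y ∷ xs} {y ∷ ys} (refl ∷ xs⊑ys) (y∉ys ∷ ys!) xs≈P =
    trans (cong (y ∷_) (⊑-unique⇒≡filter P? xs⊑ys ys! xs≈P′))
          (sym (filter-accept P? (Equivalence.to (xs≈P (here refl)) (here refl))))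
    where
    xs≈P′ : ∀ {x} → x ∈ ys → x ∈ xs ⇔ P x
    xs≈P′ x∈ys = mk⇔ (Equivalence.to (xs≈P (there x∈ys)) ∘ there) λ Px →
      case Equivalence.from (xs≈P (there x∈ys)) Px of λ where
        (here refl) → contradiction refl (All.lookup y∉ys x∈ys)
        (there x∈xs) → x∈xs

  select : (xs : List A) {m : ℕ} → m ≤ length xs → Fin m → A
  select (x ∷ xs) _         zero    = x
  select (x ∷ xs) (s≤s m≤) (suc i) = select xs m≤ i

  select-∈ : (xs : List A) {m : ℕ} (m≤ : m ≤ length xs) (i : Fin m) → select xs m≤ i ∈ xs
  select-∈ (x ∷ xs) _         zero    = here refl
  select-∈ (x ∷ xs) (s≤s m≤) (suc i) = there (select-∈ xs m≤ i)

  select-injective : {xs : List A} {m : ℕ} (m≤ : m ≤ length xs) → Unique xs →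
    ∀ {i j} → select xs m≤ i ≡ select xs m≤ j → i ≡ j
  select-injective _         _            {zero}  {zero}  _ = refl
  select-injective (s≤s m≤) (x∉xs ∷ _)   {zero}  {suc j} x≡ =
    contradiction x≡ (All.lookup x∉xs (select-∈ _ m≤ j))
  select-injective (s≤s m≤) (x∉xs ∷ _)   {suc i} {zero}  ≡x =
    contradiction (sym ≡x) (All.lookup x∉xs (select-∈ _ m≤ i))
  select-injective (s≤s m≤) (_ ∷ xs!)    {suc i} {suc j} eq = cong suc (select-injective m≤ xs! eq)

module Binomials where

  open import Data.Nat.Base using (ℕ; zero; suc; _≤_; _*_; _^_; _+_; _!)
  open import Data.Nat.Properties
  open import Data.Nat.Combinatorics using (_C_; nCk+nC[k+1]≡[n+1]C[k+1])
  open import Data.Fin.Subset using (Subset; ∣_∣; inside; outside)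
  open import Data.Vec.Base using ([]; _∷_)
  open import Data.List.Base using (List; []; _∷_; [_]; map; length; _++_)
  open import Data.List.Properties using (length-++; length-map)
  open import Data.List.Relation.Unary.Any using (here)
  open import Data.List.Membership.Propositional using (_∈_)
  open import Data.List.Membership.Propositional.Properties using (∈-map⁺; ∈-++⁺ˡ; ∈-++⁺ʳ)
  open import Relation.Binary.PropositionalEquality using (_≡_; refl; trans; cong; cong₂; module ≡-Reasoning)
  open import Data.Nat.Solver using (module +-*-Solver)
  open +-*-Solver using (solve; _:+_; _:*_; _:=_; con)

  subsetsOfSize : (n m : ℕ) → List (Subset n)
  subsetsOfSize zero    zero    = [ [] ]
  subsetsOfSize zero    (suc m) = []
  subsetsOfSize (suc n) zero    = map (outside ∷_) (subsetsOfSize n zero)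
  subsetsOfSize (suc n) (suc m) = map (inside ∷_) (subsetsOfSize n m) ++ map (outside ∷_) (subsetsOfSize n (suc m))

  length-subsetsOfSize : ∀ n m → length (subsetsOfSize n m) ≡ n C m
  length-subsetsOfSize zero    zero    = refl
  length-subsetsOfSize zero    (suc m) = refl
  length-subsetsOfSize (suc n) zero    = trans (length-map _ (subsetsOfSize n zero)) (length-subsetsOfSize n zero)
  length-subsetsOfSize (suc n) (suc m) = begin
    length (map (inside ∷_) (subsetsOfSize n m) ++ map (outside ∷_) (subsetsOfSize n (suc m)))
      ≡⟨ length-++ (map (inside ∷_) (subsetsOfSize n m)) ⟩
    length (map (inside ∷_) (subsetsOfSize n m)) + length (map (outside ∷_) (subsetsOfSize n (suc m)))
      ≡⟨ cong₂ _+_ (length-map _ (subsetsOfSize n m)) (length-map _ (subsetsOfSize n (suc m))) ⟩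
    length (subsetsOfSize n m) + length (subsetsOfSize n (suc m))
      ≡⟨ cong₂ _+_ (length-subsetsOfSize n m) (length-subsetsOfSize n (suc m)) ⟩
    n C m + n C suc m
      ≡⟨ nCk+nC[k+1]≡[n+1]C[k+1] n m ⟩
    suc n C suc m ∎
    where open ≡-Reasoning

  ∈-subsetsOfSize : ∀ {n m} (A : Subset n) → ∣ A ∣ ≡ m → A ∈ subsetsOfSize n m
  ∈-subsetsOfSize [] refl = here refl
  ∈-subsetsOfSize {suc n} (inside ∷ A) refl = ∈-++⁺ˡ (∈-map⁺ (inside ∷_) (∈-subsetsOfSize A refl))
  ∈-subsetsOfSize {suc n} {zero} (outside ∷ A) ∣A∣≡0 = ∈-map⁺ (outside ∷_) (∈-subsetsOfSize A ∣A∣≡0)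
  ∈-subsetsOfSize {suc n} {suc m} (outside ∷ A) ∣A∣≡1+m =
    ∈-++⁺ʳ (map (inside ∷_) (subsetsOfSize n m)) (∈-map⁺ (outside ∷_) (∈-subsetsOfSize A ∣A∣≡1+m))

  n^[1+m]+[1+m]*n^m≤[1+n]^[1+m] : ∀ n m → n ^ suc m + suc m * n ^ m ≤ suc n ^ suc m
  n^[1+m]+[1+m]*n^m≤[1+n]^[1+m] n zero    =
    ≤-reflexive (solve 1 (λ n → n :* con 1 :+ con 1 :* con 1 := (con 1 :+ n) :* con 1) refl n)
  n^[1+m]+[1+m]*n^m≤[1+n]^[1+m] n (suc m) = begin
    n * (n * x) + suc (suc m) * (n * x)       ≤⟨ m≤m+n _ (suc m * x) ⟩
    n * (n * x) + suc (suc m) * (n * x) + suc m * x ≡⟨ solve 3 (λ n m x → n :* (n :* x) :+ (con 2 :+ m) :* (n :* x) :+ (con 1 :+ m) :* x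
                                      := (con 1 :+ n) :* (n :* x :+ (con 1 :+ m) :* x)) refl n m x ⟩
    suc n * (n * x + suc m * x)               ≤⟨ *-monoʳ-≤ (suc n) (n^[1+m]+[1+m]*n^m≤[1+n]^[1+m] n m) ⟩
    suc n * suc n ^ suc m                     ∎
    where
    open ≤-Reasoning
    x = n ^ m

  m!*nCm≤n^m : ∀ n m → m ! * (n C m) ≤ n ^ m
  m!*nCm≤n^m zero    zero    = ≤-refl
  m!*nCm≤n^m zero    (suc m) = ≤-reflexive (*-zeroʳ (suc m !))
  m!*nCm≤n^m (suc n) zero    = ≤-refl
  m!*nCm≤n^m (suc n) (suc m) = begin
    suc m ! * (suc n C suc m)                       ≡⟨ cong (suc m ! *_) (nCk+nC[k+1]≡[n+1]C[k+1] n m) ⟨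
    suc m ! * (n C m + n C suc m)                  ≡⟨ solve 4 (λ m f x y → ((con 1 :+ m) :* f) :* (x :+ y)
                                                        := (con 1 :+ m) :* (f :* x) :+ ((con 1 :+ m) :* f) :* y)
                                                        refl m (m !) (n C m) (n C suc m) ⟩
    suc m * (m ! * (n C m)) + suc m ! * (n C suc m)    ≤⟨ +-mono-≤ (*-monoʳ-≤ (suc m) (m!*nCm≤n^m n m)) (m!*nCm≤n^m n (suc m)) ⟩
    suc m * n ^ m + n ^ suc m                      ≡⟨ +-comm (suc m * n ^ m) (n ^ suc m) ⟩
    n ^ suc m + suc m * n ^ m                      ≤⟨ n^[1+m]+[1+m]*n^m≤[1+n]^[1+m] n m ⟩
    suc n ^ suc m                                  ∎
    where open ≤-Reasoning

  nCm≤n^m : ∀ n m → n C m ≤ n ^ m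
  nCm≤n^m n m = ≤-trans (m≤n*m (n C m) (m !) {{m !≢0}}) (m!*nCm≤n^m n m)

module Matchings where

  open import Data.Nat.Base using (ℕ)
  open import Data.Fin.Subset using (Subset; Nonempty; _∩_)
  open import Data.Fin.Subset.Properties using (x∈p∩q⁺)
  open import Data.List.Base using (List; []; _∷_)
  open import Data.List.Relation.Unary.Any using (here; there)
  open import Data.List.Relation.Unary.All using (All; []; _∷_; all?)
  open import Data.List.Relation.Unary.All.Properties using (¬All⇒Any¬)
  open import Data.List.Relation.Unary.AllPairs using (AllPairs; []; _∷_)
  import Data.List.Membership.Propositional as List
  open import Data.Product.Base using (∃; _×_; _,_)
  open import Data.Sum.Base using (inj₁; inj₂)
  open import Relation.Nullary using (yes; no)
  open import Relation.Nullary.Negation using (contradiction)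
  open import Relation.Binary.PropositionalEquality using (refl)
  open Subsets using (meet-or-Disjoint)

  private variable n : ℕ

  greedyMatching : List (Subset n) → List (Subset n)
  greedyMatching []       = []
  greedyMatching (A ∷ As) with all? (disjoint? A) (greedyMatching As)
  ... | yes _ = A ∷ greedyMatching As
  ... | no  _ = greedyMatching As

  greedyMatching-⊆ : (As : List (Subset n)) {B : Subset n} → B List.∈ greedyMatching As → B List.∈ As
  greedyMatching-⊆ (A ∷ As) B∈ with all? (disjoint? A) (greedyMatching As)
  ... | no _                   = there (greedyMatching-⊆ As B∈)
  greedyMatching-⊆ (A ∷ As) (here refl)  | yes _ = here refl
  greedyMatching-⊆ (A ∷ As) (there B∈)   | yes _ = there (greedyMatching-⊆ As B∈)

  greedyMatching-disjoint : (As : List (Subset n)) → AllPairs Disjoint (greedyMatching As)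
  greedyMatching-disjoint []       = []
  greedyMatching-disjoint (A ∷ As) with all? (disjoint? A) (greedyMatching As)
  ... | yes A#M = A#M ∷ greedyMatching-disjoint As
  ... | no  _   = greedyMatching-disjoint As

  greedyMatching-maximal : (As : List (Subset n)) → All Nonempty As →
    ∀ {A} → A List.∈ As → ∃ λ B → B List.∈ greedyMatching As × Nonempty (A ∩ B)
  greedyMatching-maximal (A ∷ As) (A≠∅ ∷ As≠∅) A′∈ with all? (disjoint? A) (greedyMatching As)
  greedyMatching-maximal (A ∷ As) (A≠∅ ∷ As≠∅) (here refl) | yes _ =
    let x , x∈A = A≠∅ in A , here refl , x , x∈p∩q⁺ (x∈A , x∈A)
  greedyMatching-maximal (A ∷ As) (A≠∅ ∷ As≠∅) (there A′∈) | yes _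
    with B , B∈ , meet ← greedyMatching-maximal As As≠∅ A′∈ = B , there B∈ , meet
  greedyMatching-maximal (A ∷ As) (A≠∅ ∷ As≠∅) (there A′∈) | no _ = greedyMatching-maximal As As≠∅ A′∈
  greedyMatching-maximal (A ∷ As) (A≠∅ ∷ As≠∅) (here refl) | no ¬A#M
    with B , B∈ , ¬A#B ← List.find (¬All⇒Any¬ (disjoint? A) _ ¬A#M)
    with meet-or-Disjoint A B
  ... | inj₁ meet = B , B∈ , meet
  ... | inj₂ A#B  = contradiction A#B ¬A#B

module Family {n : ℕ} (a : ℕ) {H : List (Subset n)} (H-family : IsKFamily n (2 + a) H) where

  open import Data.Nat.Base using (suc; _<_; _*_; _^_; _+_; _∸_)
  open import Data.Nat.Properties
  open import Data.Nat.Combinatorics using (_C_)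
  import Data.Bool.Properties as Bool
  open import Data.Fin.Base using (Fin)
  import Data.Fin.Properties as Fin
  open import Data.Fin.Subset
  open import Data.Fin.Subset.Properties using (x∈⁅x⁆; x∈⁅y⁆⇒x≡y; x∈p∩q⁻; x∈p∪q⁺; x∈p∪q⁻; x∈p∧x≢y⇒x∈p-y; _∈?_)
  open import Data.Vec.Properties using (≡-dec)
  open import Data.List.Base using ([]; _∷_; [_]; map; length; _++_; filter; concatMap; allFin)
  open import Data.List.Properties using (length-++; length-map; length-filter; length-tabulate)
  open import Data.List.Relation.Unary.Any using (here; any?)
  open import Data.List.Relation.Unary.All as All using (All; []; _∷_; all?)
  open import Data.List.Relation.Unary.All.Properties using (¬All⇒Any¬; ¬Any⇒All¬; all-filter)
  open import Data.List.Relation.Unary.AllPairs using (AllPairs; []; _∷_)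
  open import Data.List.Relation.Unary.Unique.Propositional using (Unique)
  import Data.List.Relation.Unary.Unique.Propositional.Properties as Unique
  open import Data.List.Relation.Binary.Sublist.Propositional as Sublist using () renaming (_⊆_ to _⊑_)
  import Data.List.Membership.Propositional as List
  open import Data.List.Membership.DecPropositional (≡-dec {n = n} Bool._≟_) using () renaming (_∈?_ to _∈ₗ?_)
  open import Data.List.Membership.Propositional.Properties
    using (∈-map⁺; ∈-map⁻; ∈-++⁺ˡ; ∈-++⁺ʳ; ∈-++⁻; ∈-concatMap⁻; ∈-filter⁺; ∈-filter⁻; ∈-allFin)
  open import Data.Product.Base using (_,_; proj₁; proj₂)
  open import Data.Sum.Base using (_⊎_; inj₁; inj₂)
  open import Function.Base using (_∘_; id)
  open import Function.Bundles using (mk⇔)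
  open import Relation.Nullary using (Dec; yes; no; ¬?)
  open import Relation.Nullary.Negation using (¬_; contradiction)
  open import Relation.Binary.PropositionalEquality using (_≡_; _≢_; refl; sym; trans; cong; subst)
  open Subsets
  open ListCombinatorics
  open Binomials
  open Matchings

  open IsKFamily H-family renaming (unique to H-unique; uniform to H-uniform)

  private
    k : ℕ
    k = 2 + a

  IsMatching : List (Subset n) → Set
  IsMatching M = All (List._∈ H) M × AllPairs Disjoint M

  member-nonempty : {A : Subset n} → A List.∈ H → Nonempty A
  member-nonempty A∈H = ∣p∣≡1+m⇒Nonempty (All.lookup H-uniform A∈H)

  matching-unique : {M : List (Subset n)} → IsMatching M → Unique M
  matching-unique ([] , [])                      = []
  matching-unique {A ∷ M} (A∈H ∷ M⊆H , A#M ∷ M#) = All.map A≢ A#M ∷ matching-unique (M⊆H , M#)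
    where
    A≢ : ∀ {B} → Disjoint A B → A ≢ B
    A≢ A#B refl = let x , x∈A = member-nonempty A∈H in Disjoint⁻ A#B x∈A x∈A

  ν≤⇒length≤ : {s : ℕ} → ν≤ H s → {M : List (Subset n)} → IsMatching M → length M ≤ s
  ν≤⇒length≤ ν≤s M-matching = ν≤s _ (matching-unique M-matching) (proj₁ M-matching) (proj₂ M-matching)

  vertices : List (Subset n) → List (Fin n)
  vertices = concatMap elements

  ∈-vertices : {M : List (Subset n)} {A : Subset n} {x : Fin n} → A List.∈ M → x ∈ A → x List.∈ vertices M
  ∈-vertices {A = A} A∈M x∈A = ∈-concatMap-∈ elements A∈M (∈-elements⁺ A x∈A)

  length-vertices-≤ : {M : List (Subset n)} → All (List._∈ H) M → length (vertices M) ≤ length M * k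
  length-vertices-≤ {M} M⊆H = length-concatMap-≤ elements M λ {A} A∈M →
    ≤-reflexive (trans (length-elements A) (All.lookup H-uniform (All.lookup M⊆H A∈M)))

  transversal : List (Fin n)
  transversal = vertices (greedyMatching H)

  transversal-meets : {A : Subset n} → A List.∈ H → ∃ λ t → t List.∈ transversal × t ∈ A
  transversal-meets A∈H =
    let B , B∈ , x , x∈A∩B = greedyMatching-maximal H (All.tabulate member-nonempty) A∈H
        x∈A , x∈B = x∈p∩q⁻ _ B x∈A∩B
    in x , ∈-vertices B∈ x∈B , x∈A

  length-transversal-≤ : {s : ℕ} → ν≤ H s → length transversal ≤ s * k
  length-transversal-≤ ν≤s =
    ≤-trans (length-vertices-≤ M⊆H) (*-monoˡ-≤ k (ν≤⇒length≤ ν≤s (M⊆H , greedyMatching-disjoint H)))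
    where
    M⊆H : All (List._∈ H) (greedyMatching H)
    M⊆H = All.tabulate (greedyMatching-⊆ H)

  containing : Fin n → List (Subset n)
  containing y = filter (y ∈?_) H

  deg : Fin n → ℕ
  deg y = length (containing y)

  throughBoth : Fin n → Fin n → List (Subset n)
  throughBoth y w = map (λ D → (D ∪ ⁅ w ⁆) ∪ ⁅ y ⁆) (subsetsOfSize n a)

  ∈-throughBoth : {y w : Fin n} {B : Subset n} → w ≢ y → B List.∈ H → y ∈ B → w ∈ B → B List.∈ throughBoth y w
  ∈-throughBoth {y} {w} {B} w≢y B∈H y∈B w∈B = subst (List._∈ throughBoth y w) D∪w∪y≡B
    (∈-map⁺ (λ D → (D ∪ ⁅ w ⁆) ∪ ⁅ y ⁆) (∈-subsetsOfSize D ∣D∣≡a))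
    where
    w∈B-y : w ∈ B - y
    w∈B-y = x∈p∧x≢y⇒x∈p-y w∈B w≢y
    D : Subset n
    D = B - y - w
    ∣D∣≡a : ∣ D ∣ ≡ a
    ∣D∣≡a = suc-injective (suc-injective (trans (cong suc (x∈p⇒1+∣p-x∣≡∣p∣ (B - y) w∈B-y))
                                              (trans (x∈p⇒1+∣p-x∣≡∣p∣ B y∈B) (All.lookup H-uniform B∈H))))
    D∪w∪y≡B : (D ∪ ⁅ w ⁆) ∪ ⁅ y ⁆ ≡ B
    D∪w∪y≡B = trans (cong (_∪ ⁅ y ⁆) (x∈p⇒p-x∪⁅x⁆≡p (B - y) w∈B-y)) (x∈p⇒p-x∪⁅x⁆≡p B y∈B)

  avoiding-member : (W : List (Fin n)) {y : Fin n} → ¬ y List.∈ W → length W * (n C a) < deg y →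
    ∃ λ B → B List.∈ containing y × All (_∉ B) W
  avoiding-member W {y} y∉W small<deg with all? (λ B → any? (_∈? B) W) (containing y)
  ... | no ¬all-hit with B , B∈ , ¬hit ← List.find (¬All⇒Any¬ (λ B → any? (_∈? B) W) _ ¬all-hit) =
    B , B∈ , ¬Any⇒All¬ W ¬hit
  ... | yes all-hit = contradiction small<deg (≤⇒≯ deg≤)
    where
    hit⇒through : ∀ {B} → B List.∈ containing y → B List.∈ concatMap (throughBoth y) W
    hit⇒through B∈ =
      let w , w∈W , w∈B = List.find (All.lookup all-hit B∈)
          B∈H , y∈B = ∈-filter⁻ (y ∈?_) {xs = H} B∈
      in ∈-concatMap-∈ (throughBoth y) w∈W (∈-throughBoth (λ w≡y → y∉W (subst (List._∈ W) w≡y w∈W)) B∈H y∈B w∈B)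
    deg≤ : deg y ≤ length W * (n C a)
    deg≤ = ≤-trans (Unique∧⊆⇒length≤ (Unique.filter⁺ (y ∈?_) H-unique) hit⇒through)
                   (length-concatMap-≤ (throughBoth y) W λ _ →
                     ≤-reflexive (trans (length-map _ (subsetsOfSize n a)) (length-subsetsOfSize n a)))

  length-vertices-++-≤ : {M : List (Subset n)} (R : List (Fin n)) → All (List._∈ H) M →
    length (vertices M ++ R) ≤ (length M + length R) * k
  length-vertices-++-≤ {M} R M⊆H = begin
    length (vertices M ++ R)         ≡⟨ length-++ (vertices M) ⟩
    length (vertices M) + length R   ≤⟨ +-mono-≤ (length-vertices-≤ M⊆H) (m≤m*n (length R) k) ⟩
    length M * k + length R * k      ≡⟨ *-distribʳ-+ k (length M) (length R) ⟨
    (length M + length R) * k        ∎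
    where open ≤-Reasoning

  matching-step : (m : ℕ) {y : Fin n} (R : List (Fin n)) {M : List (Subset n)} → ¬ y List.∈ R →
    m * k * (n C a) < deg y → IsMatching M → All (y ∉_) M → All (λ r → All (r ∉_) M) R →
    suc (length M + length R) ≤ m → ∃ λ B → IsMatching (B ∷ M) × All (λ r → All (r ∉_) (B ∷ M)) R
  matching-step m {y} R {M} y∉R y-heavy (M⊆H , M#) y∉M R∉M size =
    let B , B∈ , B-avoids = avoiding-member (vertices M ++ R) y∉W (≤-<-trans W-small y-heavy)
    in B , (proj₁ (∈-filter⁻ (y ∈?_) {xs = H} B∈) ∷ M⊆H , B#M B-avoids ∷ M#) , R∉B∷M B-avoids
    where
    y∉W : ¬ y List.∈ vertices M ++ R
    y∉W y∈W with ∈-++⁻ (vertices M) y∈W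
    ... | inj₂ y∈R = y∉R y∈R
    ... | inj₁ y∈VM with A , A∈M , y∈A ← List.find (∈-concatMap⁻ elements y∈VM) =
      All.lookup y∉M A∈M (∈-elements⁻ A y∈A)
    W-small : length (vertices M ++ R) * (n C a) ≤ m * k * (n C a)
    W-small = *-monoˡ-≤ (n C a) (≤-trans (length-vertices-++-≤ R M⊆H) (*-monoˡ-≤ k (≤-trans (n≤1+n _) size)))
    B#M : ∀ {B} → All (_∉ B) (vertices M ++ R) → All (Disjoint B) M
    B#M B-avoids = All.tabulate λ A∈M → Disjoint⁺ λ x∈B x∈A →
      All.lookup B-avoids (∈-++⁺ˡ (∈-vertices A∈M x∈A)) x∈B
    R∉B∷M : ∀ {B} → All (_∉ B) (vertices M ++ R) → All (λ r → All (r ∉_) (B ∷ M)) R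
    R∉B∷M B-avoids = All.tabulate λ r∈R → All.lookup B-avoids (∈-++⁺ʳ (vertices M) r∈R) ∷ All.lookup R∉M r∈R

  extend-matching : (m : ℕ) (R : List (Fin n)) {M : List (Subset n)} → Unique R →
    All (λ r → m * k * (n C a) < deg r) R → IsMatching M → All (λ r → All (r ∉_) M) R →
    length M + length R ≤ m → ∃ λ M′ → IsMatching M′ × length M′ ≡ length M + length R
  extend-matching m [] {M} _ _ M-matching _ _ = M , M-matching , sym (+-identityʳ (length M))
  extend-matching m (y ∷ R) {M} (y∉R ∷ R-unique) (y-heavy ∷ R-heavy) M-matching (y∉M ∷ R∉M) size =
    let B , B∷M-matching , R∉B∷M =
          matching-step m R (λ y∈R → All.lookup y∉R y∈R refl) y-heavy M-matching y∉M R∉M size′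
        M′ , M′-matching , length-M′ = extend-matching m R R-unique R-heavy B∷M-matching R∉B∷M size′
    in M′ , M′-matching , trans length-M′ (sym (+-suc (length M) (length R)))
    where
    size′ : suc (length M + length R) ≤ m
    size′ = ≤-trans (≤-reflexive (sym (+-suc (length M) (length R)))) size

  module _ (s : ℕ) where

    threshold : ℕ
    threshold = suc s * k * (n C a)

    heavy? : (y : Fin n) → Dec (threshold < deg y)
    heavy? y = threshold <? deg y

    heavy : List (Fin n)
    heavy = filter heavy? (allFin n)

    heavy-vertices-meet-all : ν≤ H s → (x : Fin s → Fin n) → (∀ {i j} → x i ≡ x j → i ≡ j) →
      (∀ i → threshold < deg (x i)) → ∀ {A} → A List.∈ H → ∃ λ i → x i ∈ A
    heavy-vertices-meet-all ν≤s x x-injective x-heavy {A} A∈H with Fin.any? (λ i → x i ∈? A)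
    ... | yes hit = hit
    ... | no  miss =
      let M , M-matching , length-M = extend-matching (suc s) R (Unique.map⁺ x-injective (Unique.allFin⁺ s))
                                        R-heavy (A∈H ∷ [] , [] ∷ []) R∉A (≤-reflexive (cong suc length-R))
      in contradiction (subst (_≤ s) (trans length-M (cong suc length-R)) (ν≤⇒length≤ ν≤s M-matching)) (<-irrefl refl)
      where
      R : List (Fin n)
      R = map x (allFin s)
      length-R : length R ≡ s
      length-R = trans (length-map x (allFin s)) (length-tabulate id)
      R-heavy : All (λ r → threshold < deg r) R
      R-heavy = All.tabulate λ r∈R →
        let i , _ , r≡xi = ∈-map⁻ x r∈R in subst (λ r → threshold < deg r) (sym r≡xi) (x-heavy i)
      R∉A : All (λ r → All (r ∉_) [ A ]) R
      R∉A = All.tabulate λ r∈R →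
        let i , _ , r≡xi = ∈-map⁻ x r∈R in (λ r∈A → miss (i , subst (_∈ A) r≡xi r∈A)) ∷ []

    cover : ν≤ H s → s ≤ length heavy → UnionOfTrivialIntersecting s H
    cover ν≤s s≤∣heavy∣ =
      x , G , (λ _ _ → x-injective) , G-trivial , λ A → mk⇔ covered (λ (i , A∈G) → proj₁ (∈-filter⁻ (x i ∈?_) A∈G))
      where
      x : Fin s → Fin n
      x = select heavy s≤∣heavy∣
      x-injective : ∀ {i j} → x i ≡ x j → i ≡ j
      x-injective = select-injective s≤∣heavy∣ (Unique.filter⁺ heavy? (Unique.allFin⁺ n))
      x-heavy : ∀ i → threshold < deg (x i)
      x-heavy i = proj₂ (∈-filter⁻ heavy? {xs = allFin n} (select-∈ heavy s≤∣heavy∣ i))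
      G : Fin s → List (Subset n)
      G i = containing (x i)
      G-trivial : ∀ i → G i ≢ [] × All (x i ∈_) (G i)
      G-trivial i = (λ G≡[] → contradiction (subst (threshold <_) (cong length G≡[]) (x-heavy i)) λ ())
                  , all-filter (x i ∈?_) H
      covered : ∀ {A} → A List.∈ H → ∃ λ i → A List.∈ G i
      covered A∈H = let i , xi∈A = heavy-vertices-meet-all ν≤s x x-injective x-heavy A∈H
                    in i , ∈-filter⁺ (x i ∈?_) A∈H xi∈A

  -- Disjointness of the petals is not recorded: the upper bound on N(S, H) does not use it.
  record Sunflower (l : ℕ) (L : List (Subset n)) : Set where
    field
      core          : Subset n
      points        : List (Fin n)
      ∣core∣≡       : ∣ core ∣ ≡ suc a
      ⊑H            : L ⊑ H
      ≡onCore       : L ≡ onCore core points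
      points∉core   : All (_∉ core) points
      length-points : length points ≡ l

    ⊆H : All (List._∈ H) L
    ⊆H = All.tabulate (Sublist.lookup ⊑H)

  sunflower : {l : ℕ} {L : List (Subset n)} → L List.∈ filter (IsS? k) (combinations l H) → Sunflower l L
  sunflower {l} {L} L∈
    with L∈comb , K , ∣K∣ , K⊆L , _ ← ∈-filter⁻ (IsS? k) {xs = combinations l H} L∈
    with L⊑H , length-L ← ∈-combinations⁻ l H L∈comb
    with ps , L≡ , ps∉K ← petals K L
           (All.zipWith (λ (K⊆A , A∈H) → K⊆A , trans (All.lookup H-uniform A∈H) (cong suc (sym ∣K∣)))
                        (K⊆L , All.tabulate (Sublist.lookup L⊑H)))
    = record
      { core = K ; points = ps ; ∣core∣≡ = ∣K∣ ; ⊑H = L⊑H ; ≡onCore = L≡ ; points∉core = ps∉K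
      ; length-points = trans (sym (length-map _ ps)) (trans (cong length (sym L≡)) length-L) }

  open Sunflower

  -- Copies are counted as sublists of H, so a copy is recovered from its core K and its set P
  -- of petal points by filtering H.
  within : Subset n → Subset n → List (Subset n)
  within K P = filter (_∈ₗ? onCore K (elements P)) H

  sunflower≡within : {l : ℕ} {L : List (Subset n)} (σ : Sunflower l L) → L ≡ within (core σ) (fromList (points σ))
  sunflower≡within {L = L} σ = ⊑-unique⇒≡filter (_∈ₗ? L′) (⊑H σ) H-unique λ _ → mk⇔ to from
    where
    L′ : List (Subset n)
    L′ = onCore (core σ) (elements (fromList (points σ)))
    to : ∀ {A} → A List.∈ L → A List.∈ L′
    to A∈L with p , p∈ps , refl ← ∈-map⁻ _ (subst (_ List.∈_) (≡onCore σ) A∈L) =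
      ∈-map⁺ _ (∈-elements⁺ _ (∈-fromList⁺ p∈ps))
    from : ∀ {A} → A List.∈ L′ → A List.∈ L
    from A∈ with p , p∈P , refl ← ∈-map⁻ _ A∈ =
      subst (_ List.∈_) (sym (≡onCore σ)) (∈-map⁺ _ (∈-fromList⁻ (points σ) (∈-elements⁻ _ p∈P)))

  heavyCandidates : ℕ → Fin n → List (List (Subset n))
  heavyCandidates l y = concatMap (λ D → map (within (D ∪ ⁅ y ⁆)) (subsetsOfSize n l)) (subsetsOfSize n a)

  ∈-heavyCandidates : {l : ℕ} {L : List (Subset n)} (σ : Sunflower l L) {y : Fin n} → y ∈ core σ →
                      L List.∈ heavyCandidates l y
  ∈-heavyCandidates {l} {L} σ {y} y∈K =
    ∈-concatMap-∈ (λ D → map (within (D ∪ ⁅ y ⁆)) (subsetsOfSize n l)) (∈-subsetsOfSize D ∣D∣≡a)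
      (subst (List._∈ map (within (D ∪ ⁅ y ⁆)) (subsetsOfSize n l)) (sym L≡within)
        (∈-map⁺ (within (D ∪ ⁅ y ⁆)) (∈-subsetsOfSize P ∣P∣≡l)))
    where
    D P : Subset n
    D = core σ - y
    P = fromList (points σ)
    ∣D∣≡a : ∣ D ∣ ≡ a
    ∣D∣≡a = suc-injective (trans (x∈p⇒1+∣p-x∣≡∣p∣ (core σ) y∈K) (∣core∣≡ σ))
    ∣P∣≡l : ∣ P ∣ ≡ l
    ∣P∣≡l = trans (∣fromList∣≡length (Unique.map⁻ (subst Unique (≡onCore σ) (Unique-resp-⊒ (⊑H σ) H-unique))))
                  (length-points σ)
    L≡within : L ≡ within (D ∪ ⁅ y ⁆) P
    L≡within = trans (sunflower≡within σ) (cong (λ K → within K P) (sym (x∈p⇒p-x∪⁅x⁆≡p (core σ) y∈K)))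

  withFirstPetal : ℕ → Subset n → Fin n → List (List (Subset n))
  withFirstPetal m A q = map (onCore (A - q) ∘ (q ∷_)) (tuples m (allFin n))

  startingWith : ℕ → Subset n → List (List (Subset n))
  startingWith m A = concatMap (withFirstPetal m A) (elements A)

  lightCandidates : ℕ → Fin n → List (List (Subset n))
  lightCandidates m z = concatMap (startingWith m) (containing z)

  ∈-lightCandidates : {m : ℕ} {L : List (Subset n)} (σ : Sunflower (suc m) L) {z : Fin n} → z ∈ core σ →
    L List.∈ lightCandidates m z
  ∈-lightCandidates {m} {L} σ {z} z∈K with points σ in points≡ | points∉core σ | length-points σ
  ... | p ∷ ps | p∉K ∷ _ | length-ps =
    subst (List._∈ lightCandidates m z) (sym L≡)
      (∈-concatMap-∈ (startingWith m) (∈-filter⁺ (z ∈?_) A∈H (x∈p∪q⁺ (inj₁ z∈K)))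
        (∈-concatMap-∈ (withFirstPetal m A) (∈-elements⁺ A (x∈p∪q⁺ (inj₂ (x∈⁅x⁆ p))))
          (subst (λ K → onCore K (p ∷ ps) List.∈ withFirstPetal m A p) (x∉p⇒[p∪⁅x⁆]-x≡p (core σ) p∉K)
            (∈-map⁺ (onCore (A - p) ∘ (p ∷_))
              (subst (λ m → ps List.∈ tuples m (allFin n)) (suc-injective length-ps)
                (∈-tuples (allFin n) ps (All.tabulate λ {x} _ → ∈-allFin x)))))))
    where
    A : Subset n
    A = core σ ∪ ⁅ p ⁆
    L≡ : L ≡ onCore (core σ) (p ∷ ps)
    L≡ = trans (≡onCore σ) (cong (onCore (core σ)) points≡)
    A∈H : A List.∈ H
    A∈H = All.lookup (⊆H σ) (subst (A List.∈_) (sym L≡) (here refl))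

  transversalCandidates : ℕ → List (List (Subset n))
  transversalCandidates l = concatMap (λ K → map (onCore K) (tuples l transversal)) (subsetsOfSize n (suc a))

  ∈-transversalCandidates : {l : ℕ} {L : List (Subset n)} (σ : Sunflower l L) → All (_∉ core σ) transversal →
    L List.∈ transversalCandidates l
  ∈-transversalCandidates {l} σ T∉K =
    ∈-concatMap-∈ (λ K → map (onCore K) (tuples l transversal)) (∈-subsetsOfSize (core σ) (∣core∣≡ σ))
      (subst (List._∈ _) (sym (≡onCore σ)) (∈-map⁺ (onCore (core σ))
        (subst (λ l → points σ List.∈ tuples l transversal) (length-points σ)
          (∈-tuples transversal (points σ) (All.tabulate points∈T)))))
    where
    points∈T : ∀ {p} → p List.∈ points σ → p List.∈ transversal
    points∈T {p} p∈ps
      with t , t∈T , t∈A ← transversal-meets (All.lookup (⊆H σ) (subst (_ List.∈_) (sym (≡onCore σ)) (∈-map⁺ _ p∈ps)))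
      with x∈p∪q⁻ (core σ) ⁅ p ⁆ t∈A
    ... | inj₁ t∈K = contradiction t∈K (All.lookup T∉K t∈T)
    ... | inj₂ t∈p = subst (List._∈ transversal) (x∈⁅y⁆⇒x≡y p t∈p) t∈T

  length-heavyCandidates : (l : ℕ) (y : Fin n) → length (heavyCandidates l y) ≤ (n C a) * (n C l)
  length-heavyCandidates l y = subst (λ c → length (heavyCandidates l y) ≤ c * (n C l)) (length-subsetsOfSize n a)
    (length-concatMap-≤ _ (subsetsOfSize n a) λ _ →
      ≤-reflexive (trans (length-map _ (subsetsOfSize n l)) (length-subsetsOfSize n l)))

  length-lightCandidates : (m : ℕ) (z : Fin n) → length (lightCandidates m z) ≤ deg z * (k * n ^ m)
  length-lightCandidates m z = length-concatMap-≤ (startingWith m) (containing z) λ {A} A∈ →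
    subst (λ c → length (startingWith m A) ≤ c * n ^ m)
          (trans (length-elements A) (All.lookup H-uniform (proj₁ (∈-filter⁻ (z ∈?_) {xs = H} A∈))))
      (length-concatMap-≤ (withFirstPetal m A) (elements A) λ _ →
        ≤-trans (≤-reflexive (length-map _ (tuples m (allFin n))))
                (subst (λ c → length (tuples m (allFin n)) ≤ c ^ m) (length-tabulate id) (length-tuples-≤ m (allFin n))))

  length-transversalCandidates : (l : ℕ) → length (transversalCandidates l) ≤ (n C suc a) * length transversal ^ l
  length-transversalCandidates l = subst (λ c → length (transversalCandidates l) ≤ c * length transversal ^ l)
    (length-subsetsOfSize n (suc a))
    (length-concatMap-≤ _ (subsetsOfSize n (suc a)) λ _ →
      ≤-trans (≤-reflexive (length-map _ (tuples l transversal))) (length-tuples-≤ l transversal))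

  module _ (s m : ℕ) where

    light : List (Fin n)
    light = filter (¬? ∘ heavy? s) transversal

    heavyPart lightPart candidates : List (List (Subset n))
    heavyPart  = concatMap (heavyCandidates (suc m)) (heavy s)
    lightPart  = concatMap (lightCandidates m) light
    candidates = heavyPart ++ lightPart ++ transversalCandidates (suc m)

    sunflower-∈-candidates : {L : List (Subset n)} → L List.∈ filter (IsS? k) (combinations (suc m) H) →
                             L List.∈ candidates
    sunflower-∈-candidates L∈ with sunflower L∈
    ... | σ with any? (_∈? core σ) transversal
    ... | no none = ∈-++⁺ʳ heavyPart (∈-++⁺ʳ lightPart (∈-transversalCandidates σ (¬Any⇒All¬ transversal none)))
    ... | yes some with z , z∈T , z∈K ← List.find some with heavy? s z
    ... | yes z-heavy = ∈-++⁺ˡ (∈-concatMap-∈ (heavyCandidates (suc m)) (∈-filter⁺ (heavy? s) (∈-allFin z) z-heavy)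
                                             (∈-heavyCandidates σ z∈K))
    ... | no  z-light = ∈-++⁺ʳ heavyPart (∈-++⁺ˡ (∈-concatMap-∈ (lightCandidates m) (∈-filter⁺ (¬? ∘ heavy? s) z∈T z-light)
                                                             (∈-lightCandidates σ z∈K)))

    NS≤ : NS k (suc m) H ≤ length (heavy s) * ((n C a) * (n C suc m))
                        + (length transversal * (threshold s * (k * n ^ m)) + (n C suc a) * length transversal ^ suc m)
    NS≤ = begin
      NS k (suc m) H
        ≤⟨ Unique∧⊆⇒length≤ (Unique.filter⁺ (IsS? k) (Unique-combinations (suc m) H-unique)) sunflower-∈-candidates ⟩
      length candidates
        ≡⟨ trans (length-++ heavyPart) (cong (length heavyPart +_) (length-++ lightPart)) ⟩
      length heavyPart + (length lightPart + length (transversalCandidates (suc m)))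
        ≤⟨ +-mono-≤ (length-concatMap-≤ _ (heavy s) λ {y} _ → length-heavyCandidates (suc m) y)
                    (+-mono-≤ lightPart≤ (length-transversalCandidates (suc m))) ⟩
      length (heavy s) * ((n C a) * (n C suc m))
        + (length transversal * (threshold s * (k * n ^ m)) + (n C suc a) * length transversal ^ suc m) ∎
      where
      open ≤-Reasoning
      lightPart≤ : length lightPart ≤ length transversal * (threshold s * (k * n ^ m))
      lightPart≤ = ≤-trans
        (length-concatMap-≤ (lightCandidates m) light λ {z} z∈ →
          ≤-trans (length-lightCandidates m z) (*-monoˡ-≤ (k * n ^ m) (≮⇒≥ (proj₂ (∈-filter⁻ _ {xs = transversal} z∈)))))
        (*-monoˡ-≤ _ (length-filter _ transversal))

    dichotomy : ν≤ H s → UnionOfTrivialIntersecting s H ⊎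
      NS k (suc m) H ≤ (s ∸ 1) * ((n C a) * (n C suc m))
                       + (s * k * (threshold s * (k * n ^ m)) + (n C suc a) * (s * k) ^ suc m)
    dichotomy ν≤s with s ≤? length (heavy s)
    ... | yes s≤∣heavy∣ = inj₁ (cover s ν≤s s≤∣heavy∣)
    ... | no  s≰∣heavy∣ = inj₂ (≤-trans NS≤ (+-mono-≤ (*-monoˡ-≤ _ (∸-monoˡ-≤ 1 (≰⇒> s≰∣heavy∣)))
                                              (+-mono-≤ (*-monoˡ-≤ _ T≤) (*-monoʳ-≤ (n C suc a) (^-monoˡ-≤ (suc m) T≤)))))
      where
      T≤ : length transversal ≤ s * k
      T≤ = length-transversal-≤ ν≤s

module Asymptotics where

  open import Data.Nat.Base
    using (ℕ; zero; suc; _≤_; _<_; _*_; _^_; _+_; _∸_; s≤s; NonZero; _!; >-nonZero; >-nonZero⁻¹)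
  open import Data.Nat.Properties
  open import Data.Nat.Combinatorics using (_C_)
  open import Data.Nat.Solver using (module +-*-Solver)
  open +-*-Solver using (solve; _:+_; _:*_; _:=_)
  open import Data.Integer.Base as ℤ using (ℤ; +_; +[1+_]; -[1+_]; +<+)
  import Data.Integer.Properties as ℤ
  open import Data.Integer.GCD using (gcd)
  open import Data.Rational.Base as ℚ using (ℚ; mkℚ; toℚᵘ; ↥_; ↧_; 0ℚ; *<*)
  import Data.Rational.Properties as ℚ
  open import Data.Rational.Unnormalised.Base as ℚᵘ using (mkℚᵘ; *≡*; *≤*)
  import Data.Rational.Unnormalised.Properties as ℚᵘ
  open import Data.Product.Base using (∃₂; _,_)
  open import Relation.Binary.PropositionalEquality
    using (_≡_; refl; sym; trans; cong; cong₂; subst; subst₂; module ≡-Reasoning)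
  open Binomials using (m!*nCm≤n^m; nCm≤n^m)

  toℚᵘ-/ : ∀ i d .{{_ : NonZero d}} → toℚᵘ (i ℚ./ d) ℚᵘ.≃ i ℚᵘ./ d
  toℚᵘ-/ i (suc f) = *≡* (begin
    ℚᵘ.↥ (toℚᵘ q) ℤ.* + suc f  ≡⟨ cong (ℤ._* + suc f) (ℚ.↥ᵘ-toℚᵘ q) ⟩
    ↥ q ℤ.* + suc f            ≡⟨ cong (↥ q ℤ.*_) (ℚ.↧-/ i (suc f)) ⟨
    ↥ q ℤ.* (↧ q ℤ.* g)        ≡⟨ cong (↥ q ℤ.*_) (ℤ.*-comm (↧ q) g) ⟩
    ↥ q ℤ.* (g ℤ.* ↧ q)        ≡⟨ ℤ.*-assoc (↥ q) g (↧ q) ⟨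
    (↥ q ℤ.* g) ℤ.* ↧ q        ≡⟨ cong (ℤ._* ↧ q) (ℚ.↥-/ i (suc f)) ⟩
    i ℤ.* ↧ q                  ≡⟨ cong (i ℤ.*_) (ℚ.↧ᵘ-toℚᵘ q) ⟨
    i ℤ.* ℚᵘ.↧ (toℚᵘ q)        ∎)
    where
    open ≡-Reasoning
    q : ℚ
    q = i ℚ./ suc f
    g : ℤ
    g = gcd i (+ suc f)

  cross-multiply : ∀ c F x N p d .{{_ : NonZero F}} (ε : ℚ) → toℚᵘ ε ≡ mkℚᵘ (+ p) d →
    ((+ c) ℚ./ F ℚ.+ ε) ℚ.* ℕ→ℚ x ℚ.≤ ℕ→ℚ N → (c * suc d + p * F) * x ≤ N * (F * suc d)
  cross-multiply c F@(suc f) x N p d ε ε≡ ineq =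
    in-ℕ (ℚᵘ.≤-respˡ-≃ lhs≃ (ℚᵘ.≤-respʳ-≃ (toℚᵘ-/ (+ N) 1) (ℚ.toℚᵘ-mono-≤ ineq)))
    where
    lhs≃ : toℚᵘ (((+ c) ℚ./ F ℚ.+ ε) ℚ.* ℕ→ℚ x) ℚᵘ.≃ (mkℚᵘ (+ c) f ℚᵘ.+ mkℚᵘ (+ p) d) ℚᵘ.* mkℚᵘ (+ x) 0
    lhs≃ = ℚᵘ.≃-trans (ℚ.toℚᵘ-homo-* ((+ c) ℚ./ F ℚ.+ ε) (ℕ→ℚ x))
             (ℚᵘ.*-cong (ℚᵘ.≃-trans (ℚ.toℚᵘ-homo-+ ((+ c) ℚ./ F) ε)
                                    (ℚᵘ.+-cong (toℚᵘ-/ (+ c) F) (ℚᵘ.≃-reflexive ε≡)))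
                        (toℚᵘ-/ (+ x) 1))
    lhsℤ : ((+ c ℤ.* + suc d ℤ.+ + p ℤ.* + F) ℤ.* + x) ℤ.* + 1 ≡ + ((c * suc d + p * F) * x)
    lhsℤ = begin
      ((+ c ℤ.* + suc d ℤ.+ + p ℤ.* + F) ℤ.* + x) ℤ.* + 1  ≡⟨ ℤ.*-identityʳ _ ⟩
      (+ c ℤ.* + suc d ℤ.+ + p ℤ.* + F) ℤ.* + x
        ≡⟨ cong₂ (λ u v → (u ℤ.+ v) ℤ.* + x) (ℤ.pos-* c (suc d)) (ℤ.pos-* p F) ⟨
      (+ (c * suc d) ℤ.+ + (p * F)) ℤ.* + x               ≡⟨ cong (ℤ._* + x) (ℤ.pos-+ (c * suc d) (p * F)) ⟨
      + (c * suc d + p * F) ℤ.* + x                       ≡⟨ ℤ.pos-* (c * suc d + p * F) x ⟨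
      + ((c * suc d + p * F) * x)                         ∎
      where open ≡-Reasoning
    rhsℤ : + N ℤ.* + (F * suc d * 1) ≡ + (N * (F * suc d))
    rhsℤ = trans (sym (ℤ.pos-* N _)) (cong (λ t → + (N * t)) (*-identityʳ (F * suc d)))
    in-ℕ : (mkℚᵘ (+ c) f ℚᵘ.+ mkℚᵘ (+ p) d) ℚᵘ.* mkℚᵘ (+ x) 0 ℚᵘ.≤ mkℚᵘ (+ N) 0 →
           (c * suc d + p * F) * x ≤ N * (F * suc d)
    in-ℕ (*≤* ineqℤ) = ℤ.drop‿+≤+ (subst₂ ℤ._≤_ lhsℤ rhsℤ ineqℤ)

  positive-fraction : (ε : ℚ) → 0ℚ ℚ.< ε → ∃₂ λ p d → toℚᵘ ε ≡ mkℚᵘ (+ suc p) d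
  positive-fraction (mkℚ +[1+ p ] d _) _ = p , d , refl
  positive-fraction (mkℚ (+ zero) d _) (*<* (+<+ ()))
  positive-fraction (mkℚ -[1+ _ ] d _) (*<* ())

  -- Cross-multiplied, the hypotheses read (c/F + sp/sd)·nP ≤ N ≤ cX + E with FX ≤ nP and E ≤ KP,
  -- which leaves sp·n ≤ K·sd.
  n≤K*sd : ∀ {c F sd sp X N E K n P} → (c * sd + suc sp * F) * (n * P) ≤ N * (F * sd) →
    N ≤ c * X + E → F * X ≤ n * P → E ≤ K * P → 0 < F → 0 < P → n ≤ K * sd
  n≤K*sd {c} {F@(suc _)} {sd} {sp} {X} {N} {E} {K} {n} {P@(suc _)} lower upper main error _ _ =
    ≤-trans (m≤n*m n (suc sp))
            (*-cancelˡ-≤ (F * P) (subst₂ _≤_ lhs≡ rhs≡ (+-cancelˡ-≤ (c * sd * (n * P)) _ _ chain)))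
    where
    open ≤-Reasoning
    chain : c * sd * (n * P) + suc sp * F * (n * P) ≤ c * sd * (n * P) + K * P * (F * sd)
    chain = begin
      c * sd * (n * P) + suc sp * F * (n * P) ≡⟨ *-distribʳ-+ (n * P) (c * sd) (suc sp * F) ⟨
      (c * sd + suc sp * F) * (n * P)         ≤⟨ lower ⟩
      N * (F * sd)                            ≤⟨ *-monoˡ-≤ (F * sd) upper ⟩
      (c * X + E) * (F * sd)                  ≡⟨ solve 5 (λ c X E F sd → (c :* X :+ E) :* (F :* sd)
                                                                   := c :* sd :* (F :* X) :+ E :* (F :* sd))
                                                   refl c X E F sd ⟩
      c * sd * (F * X) + E * (F * sd)         ≤⟨ +-mono-≤ (*-monoʳ-≤ (c * sd) main) (*-monoˡ-≤ (F * sd) error) ⟩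
      c * sd * (n * P) + K * P * (F * sd)     ∎
    lhs≡ : suc sp * F * (n * P) ≡ F * P * (suc sp * n)
    lhs≡ = solve 4 (λ sp F n P → sp :* F :* (n :* P) := F :* P :* (sp :* n)) refl (suc sp) F n P
    rhs≡ : K * P * (F * sd) ≡ F * P * (K * sd)
    rhs≡ = solve 4 (λ K P F sd → K :* P :* (F :* sd) := F :* P :* (K :* sd)) refl K P F sd

  nCa*nCl-bound : ∀ n a l → a ! * l ! * ((n C a) * (n C l)) ≤ n ^ (a + l)
  nCa*nCl-bound n a l = begin
    a ! * l ! * ((n C a) * (n C l))      ≡⟨ solve 4 (λ x y u v → (x :* y) :* (u :* v) := (x :* u) :* (y :* v))
                                                   refl (a !) (l !) (n C a) (n C l) ⟩
    a ! * (n C a) * (l ! * (n C l))      ≤⟨ *-mono-≤ (m!*nCm≤n^m n a) (m!*nCm≤n^m n l) ⟩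
    n ^ a * n ^ l                        ≡⟨ ^-distribˡ-+-* n a l ⟨
    n ^ (a + l)                          ∎
    where open ≤-Reasoning

  errorConstant : (a b s : ℕ) → ℕ
  errorConstant a b s = s * k * (suc s * k * k) + (s * k) ^ (2 + b)
    where
    k : ℕ
    k = 2 + a

  error-bound : ∀ a b s n .{{_ : NonZero n}} → let k = 2 + a in
    s * k * (suc s * k * (n C a) * (k * n ^ suc b)) + (n C suc a) * (s * k) ^ (2 + b)
      ≤ errorConstant a b s * n ^ (a + suc b)
  error-bound a b s n = begin
    s * k * (suc s * k * (n C a) * (k * n ^ suc b)) + (n C suc a) * (s * k) ^ (2 + b)
      ≤⟨ +-mono-≤ (*-monoʳ-≤ (s * k) (*-monoˡ-≤ (k * n ^ suc b) (*-monoʳ-≤ (suc s * k) (nCm≤n^m n a))))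
                  (*-monoˡ-≤ ((s * k) ^ (2 + b)) (≤-trans (nCm≤n^m n (suc a)) (^-monoʳ-≤ n a+1≤a+[1+b]))) ⟩
    s * k * (suc s * k * n ^ a * (k * n ^ suc b)) + n ^ (a + suc b) * (s * k) ^ (2 + b)
      ≡⟨ cong₂ _+_ (trans (solve 5 (λ s k x t y → s :* k :* (t :* k :* x :* (k :* y))
                                                   := s :* k :* (t :* k :* k) :* (x :* y))
                                  refl s k (n ^ a) (suc s) (n ^ suc b))
                           (cong (s * k * (suc s * k * k) *_) (sym (^-distribˡ-+-* n a (suc b)))))
                   (*-comm (n ^ (a + suc b)) ((s * k) ^ (2 + b))) ⟩
    s * k * (suc s * k * k) * n ^ (a + suc b) + (s * k) ^ (2 + b) * n ^ (a + suc b)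
      ≡⟨ *-distribʳ-+ (n ^ (a + suc b)) (s * k * (suc s * k * k)) ((s * k) ^ (2 + b)) ⟨
    errorConstant a b s * n ^ (a + suc b) ∎
    where
    open ≤-Reasoning
    k : ℕ
    k = 2 + a
    a+1≤a+[1+b] : suc a ≤ a + suc b
    a+1≤a+[1+b] = subst (suc a ≤_) (sym (+-suc a b)) (s≤s (m≤m+n a b))

  count-bounds⇒n≤ : ∀ a b s n N p d (ε : ℚ) → toℚᵘ ε ≡ mkℚᵘ (+ suc p) d → 0 < n →
    (coeff (2 + a) s (2 + b) ℚ.+ ε) ℚ.* ℕ→ℚ (n ^ (a + (2 + b))) ℚ.≤ ℕ→ℚ N →
    N ≤ (s ∸ 1) * ((n C a) * (n C (2 + b)))
        + (s * (2 + a) * (suc s * (2 + a) * (n C a) * ((2 + a) * n ^ suc b)) + (n C suc a) * (s * (2 + a)) ^ (2 + b)) →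
    n ≤ errorConstant a b s * suc d
  count-bounds⇒n≤ a b s n N p d ε ε≡ 0<n lower upper =
    n≤K*sd {c = s ∸ 1} {sp = p} {K = errorConstant a b s} lower′ upper main (error-bound a b s n)
           (>-nonZero⁻¹ F {{F≢0}}) (m^n>0 n (a + suc b))
    where
    instance
      n≢0 : NonZero n
      n≢0 = >-nonZero 0<n
    F P : ℕ
    F = a ! * (2 + b) !
    P = n ^ (a + suc b)
    F≢0 : NonZero F
    F≢0 = a !* (2 + b) !≢0
    n^[a+l]≡n*P : n ^ (a + (2 + b)) ≡ n * P
    n^[a+l]≡n*P = cong (n ^_) (+-suc a (suc b))
    lower′ : ((s ∸ 1) * suc d + suc p * F) * (n * P) ≤ N * (F * suc d)
    lower′ = subst (λ x → ((s ∸ 1) * suc d + suc p * F) * x ≤ N * (F * suc d)) n^[a+l]≡n*P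
                   (cross-multiply (s ∸ 1) F _ N (suc p) d {{F≢0}} ε ε≡ lower)
    main : F * ((n C a) * (n C (2 + b))) ≤ n * P
    main = subst (F * ((n C a) * (n C (2 + b))) ≤_) n^[a+l]≡n*P (nCa*nCl-bound n a (2 + b))

open import Data.Rational using (ℚ; 0ℚ; _<_) renaming (_≤_ to _≤ℚ_; _+_ to _+ℚ_; _*_ to _*ℚ_)
open import Data.Nat.Base using (suc; _*_; z≤n; s≤s)
open import Data.Nat.Properties using (≤-trans; <⇒≱)
open import Data.Product using (_,_)
open import Data.Sum.Base using ([_,_]′)
open import Function.Base using (id)
open import Relation.Nullary.Negation using (contradiction)
open Asymptotics using (positive-fraction; errorConstant; count-bounds⇒n≤)

theorem2p1 : (k s l : ℕ) → 1 ≤ s → 2 ≤ k → 2 ≤ l →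
    (ε : ℚ) → 0ℚ < ε →
    ∃ λ nε → (n : ℕ) → nε ≤ n → (H : List (Subset n)) →
      IsKFamily n k H → ν≤ H s →
      (coeff k s l +ℚ ε) *ℚ ℕ→ℚ (n ^ (k + l ∸ 2)) ≤ℚ ℕ→ℚ (NS k l H) →
      UnionOfTrivialIntersecting s H
theorem2p1 (suc (suc a)) s (suc (suc b)) _ (s≤s (s≤s z≤n)) (s≤s (s≤s z≤n)) ε 0<ε
  with p , d , ε≡ ← positive-fraction ε 0<ε
  = suc (errorConstant a b s * suc d) , λ n n-large H H-family ν≤s NS-large →
    [ id , (λ NS≤ → contradiction (count-bounds⇒n≤ a b s n _ p d ε ε≡ (≤-trans (s≤s z≤n) n-large) NS-large NS≤)
                                  (<⇒≱ n-large)) ]′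
      (Family.dichotomy a H-family s (suc b) ν≤s)
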